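{- Let $p$ be a prime, $n\ge2$, and let $\beta=(\beta_1,\dots,\beta_{n-1})$ be a tuple of integers with $\beta_1>1$, $\beta_i>0$ for $i\in\{2,\dots,n-1\}$, and $\sum_{i=1}^{n-1}\beta_i>n$. Let $m_\beta=\min\{\lfloor \beta_1/2\rfloor,\beta_2,\dots,\beta_{n-1}\}$. Then \[g_\beta(p)\ge p^{(n-2)m_\beta}.\]
   Context: For a prime $p$ and a tuple $\beta=(\beta_1,\dots,\beta_{n-1})$ of positive integers, an irreducible subring matrix with diagonal $\beta$ is an $n\times n$ upper triangular integer matrix $A$ with $A_{ii}=p^{\beta_i}$ for $1\le i\le n-1$, $A_{nn}=1$, $A_{in}=1$ for all $i$, and $A_{ij}=p\,a_{ij}$ with integers $0\le a_{ij}\le p^{\beta_i-1}-1$ for $1\le i<j\le n-1$, such that the $\mathbb{Z}$-span of the columns of $A$ is closed under componentwise multiplication of vectors. $g_\beta(p)$ denotes the number of irreducible subring matrices with diagonal $\beta$. -}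

module Defs where

open import Data.Nat as ℕ using (ℕ; zero; suc; _∸_; _<_; _/_)
open import Data.Integer as ℤ using (ℤ; +_)
open import Data.Fin using (Fin; zero; suc; inject₁; fromℕ; toℕ)
open import Data.Product using (Σ; ∃; _×_)
open import Relation.Binary.PropositionalEquality using (_≡_)

sumℤ : ∀ {m} → (Fin m → ℤ) → ℤ
sumℤ {zero}  v = + 0
sumℤ {suc m} v = v zero ℤ.+ sumℤ (λ i → v (suc i))

sumℕ : ∀ {m} → (Fin m → ℕ) → ℕ
sumℕ {zero}  v = 0
sumℕ {suc m} v = v zero ℕ.+ sumℕ (λ i → v (suc i))

minFrom : ∀ {m} → ℕ → (Fin m → ℕ) → ℕ
minFrom {zero}  a v = a
minFrom {suc m} a v = minFrom (ℕ._⊓_ a (v zero)) (λ i → v (suc i))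

-- m_β = min { ⌊β₁/2⌋, β₂, …, β_{n-1} }, for β = (β₁,…,β_{n-1}) with n-1 = suc k.
mβ : ∀ {k} → (Fin (suc k) → ℕ) → ℕ
mβ β = minFrom (β zero / 2) (λ i → β (suc i))

Matrix : ℕ → Set
Matrix n = Fin n → Fin n → ℤ

InColumnSpan : ∀ {n} → Matrix n → (Fin n → ℤ) → Set
InColumnSpan {n} A v = ∃ λ (c : Fin n → ℤ) → ∀ r → v r ≡ sumℤ (λ j → A r j ℤ.* c j)

SpanMulClosed : ∀ {n} → Matrix n → Set
SpanMulClosed A = ∀ x y → InColumnSpan A x → InColumnSpan A y →
                  InColumnSpan A (λ r → x r ℤ.* y r)

-- Irreducible subring matrix with diagonal β, where the matrix has size
-- n = suc k and β : Fin k → ℕ is (β₁,…,β_{n-1}).  Row/column i of β is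
-- 'inject₁ i'; row/column n is 'fromℕ k'.
record IsIrredSubringMatrix (p : ℕ) {k : ℕ} (β : Fin k → ℕ) (A : Matrix (suc k)) : Set where
  field
    upperTriangular : ∀ (i j : Fin (suc k)) → toℕ j < toℕ i → A i j ≡ + 0
    diag            : ∀ (i : Fin k) → A (inject₁ i) (inject₁ i) ≡ + (p ℕ.^ β i)
    lastDiag        : A (fromℕ k) (fromℕ k) ≡ + 1
    lastColumn      : ∀ (i : Fin (suc k)) → A i (fromℕ k) ≡ + 1
    offDiag         : ∀ (i j : Fin k) → toℕ i < toℕ j →
                        ∃ λ (a : ℕ) → (a < p ℕ.^ (β i ∸ 1)) ×
                                      (A (inject₁ i) (inject₁ j) ≡ + (p ℕ.* a))
    subring         : SpanMulClosed A

-- Let P = p^β₁, Bᵢ = p^βᵢ and q = p^(β₁ - m).  The lattice spanned by the columns of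
--
--     P  q b₂ … q b_n  1
--        B₂            1
--             ⋱        ⋮
--                 B_n  1
--                      1
--
-- is closed under multiplication, whatever the integers bᵢ, as soon as P divides q² and
-- every q Bᵢ: in the product of two lattice vectors all coordinates but the first are
-- those of a lattice vector, and the first one is off only by multiples of q² and of the
-- q Bᵢ.  These divisibilities mean 2m ≤ β₁ and m ≤ βᵢ, so they hold for m = m_β; since
-- also m < β₁, the top entries q bᵢ with 0 ≤ bᵢ < p^m have the required form p aᵢ with
-- aᵢ < p^(β₁-1).  The p^((n-2)m) choices of the bᵢ give distinct matrices.
module Submission where

open import Defs
open import Data.Fin using (Fin; zero; suc; inject₁; fromℕ; toℕ; cast; punchIn; combine; funToFin; finToFun)
open import Data.Fin.Properties
  using (toℕ-injective; toℕ-inject₁; toℕ-fromℕ; toℕ<n; toℕ-cast; punchInᵢ≢i; funToFin-finToFin)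
open import Data.Fin.Relation.Unary.Top using (View; ‵fromℕ; ‵inject₁; view; view-fromℕ; view-inject₁)
open import Data.Nat as ℕ using (ℕ; zero; suc; _≤_; _<_; _∸_; NonZero)
import Data.Nat.Properties as ℕ
open import Data.Product using (Σ; ∃; _×_; _,_)
open import Data.Vec.Functional using (Vector; head; tail; init; last; updateAt; replicate)
open import Data.Vec.Functional.Properties using (updateAt-updates; updateAt-minimal)
open import Function using (_∘_; const)
open import Relation.Binary.PropositionalEquality
open import Relation.Nullary using (¬_; contradiction)
open ≡-Reasoning

funToFin-cong : ∀ {m n} {f g : Fin m → Fin n} → f ≗ g → funToFin f ≡ funToFin g
funToFin-cong {zero}  f≗g = refl
funToFin-cong {suc m} f≗g = cong₂ combine (f≗g zero) (funToFin-cong (f≗g ∘ suc))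

finToFun-injective : ∀ {m n} {s t : Fin (m ℕ.^ n)} → finToFun {m} {n} s ≗ finToFun t → s ≡ t
finToFun-injective {m} {n} {s} {t} s≗t = begin
  s                                 ≡⟨ funToFin-finToFin {n} {m} s ⟨
  funToFin (finToFun {m} {n} s)     ≡⟨ funToFin-cong {n} {m} s≗t ⟩
  funToFin (finToFun {m} {n} t)     ≡⟨ funToFin-finToFin {n} {m} t ⟩
  t                                 ∎

cast-injective : ∀ {m n} .(eq : m ≡ n) {s t : Fin m} → cast eq s ≡ cast eq t → s ≡ t
cast-injective eq {s} {t} cs≡ct = toℕ-injective (begin
  toℕ s            ≡⟨ toℕ-cast eq s ⟨
  toℕ (cast eq s)  ≡⟨ cong toℕ cs≡ct ⟩
  toℕ (cast eq t)  ≡⟨ toℕ-cast eq t ⟩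
  toℕ t            ∎)

fromℕ≮inject₁ : ∀ {k} (i : Fin k) → ¬ toℕ (fromℕ k) < toℕ (inject₁ i)
fromℕ≮inject₁ {k} i rewrite toℕ-fromℕ k | toℕ-inject₁ i = ℕ.<⇒≯ (toℕ<n i)

byParts : ∀ {k ℓ} (Q : Fin (suc (suc k)) → Set ℓ) →
          Q zero → (∀ i → Q (suc (inject₁ i))) → Q (fromℕ (suc k)) → ∀ r → Q r
byParts Q q₀ qₘ qₗ zero = q₀
byParts Q q₀ qₘ qₗ (suc j) with view j
... | ‵inject₁ i = qₘ i
... | ‵fromℕ     = qₗ

glue : ∀ {X : Set} {k} → X → Vector X k → X → Vector X (suc (suc k))
glue a m l zero    = a
glue a m l (suc j) = onView (view j)
  where
  onView : ∀ {j} → View j → _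
  onView (‵inject₁ i) = m i
  onView ‵fromℕ       = l

mid : ∀ {X : Set} {k} → Vector X (suc (suc k)) → Vector X k
mid c = init (tail c)

mid-glue : ∀ {X : Set} {k} a (m : Vector X k) l i → mid (glue a m l) i ≡ m i
mid-glue a m l i rewrite view-inject₁ i = refl

last-glue : ∀ {X : Set} {k} a (m : Vector X k) l → last (glue a m l) ≡ l
last-glue {k = k} a m l rewrite view-fromℕ k = refl

module _ where

  open import Data.Integer using (ℤ; +_; 0ℤ; 1ℤ; _+_; _*_; _-_)
  import Data.Integer.Properties as ℤ
  open import Algebra.Properties.Semiring.Sum ℤ.+-*-semiring
    using (sum; sum-cong-≗; sum-init-last; sum-remove; sum-replicate-zero; ∑-distrib-+; *-distribˡ-sum)
  open import Data.Integer.Tactic.RingSolver using (solve-∀)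

  sumℤ≡sum : ∀ {m} (f : Vector ℤ m) → sumℤ f ≡ sum f
  sumℤ≡sum {zero}  f = refl
  sumℤ≡sum {suc m} f = cong (_+_ (f zero)) (sumℤ≡sum (tail f))

  sum-single : ∀ {m} (i : Fin m) (f : Vector ℤ m) → (∀ j → j ≢ i → f j ≡ 0ℤ) → sum f ≡ f i
  sum-single {suc m} i f f≡0 = begin
    sum f                     ≡⟨ sum-remove f ⟩
    f i + sum (f ∘ punchIn i) ≡⟨ cong (_+_ (f i)) (trans (sum-cong-≗ (λ j → f≡0 _ (punchInᵢ≢i i j)))
                                                          (sum-replicate-zero m)) ⟩
    f i + 0ℤ                  ≡⟨ ℤ.+-identityʳ (f i) ⟩
    f i                       ∎

  dot : ∀ {n} → Vector ℤ n → Vector ℤ n → ℤ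
  dot u c = sumℤ (λ j → u j * c j)

  mulVec : ∀ {n} → Matrix n → Vector ℤ n → Vector ℤ n
  mulVec A c r = dot (A r) c

  dot-glue : ∀ {k} a (m : Vector ℤ k) l (c : Vector ℤ (suc (suc k))) →
             dot (glue a m l) c ≡ a * head c + (sum (λ i → m i * mid c i) + l * last c)
  dot-glue a m l c = begin
    dot (glue a m l) c
      ≡⟨ sumℤ≡sum (λ j → glue a m l j * c j) ⟩
    a * head c + sum (λ j → glue a m l (suc j) * c (suc j))
      ≡⟨ cong (_+_ (a * head c)) (sum-init-last (λ j → glue a m l (suc j) * c (suc j))) ⟩
    a * head c + (sum (λ i → mid (glue a m l) i * mid c i) + last (glue a m l) * last c)
      ≡⟨ cong₂ (λ s t → a * head c + (s + t * last c))
               (sum-cong-≗ (λ i → cong (_* mid c i) (mid-glue a m l i))) (last-glue a m l) ⟩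
    a * head c + (sum (λ i → m i * mid c i) + l * last c) ∎

  dot-glue₀₁ : ∀ {k} (m : Vector ℤ k) (c : Vector ℤ (suc (suc k))) →
               dot (glue 0ℤ m 1ℤ) c ≡ sum (λ i → m i * mid c i) + last c
  dot-glue₀₁ m c = begin
    dot (glue 0ℤ m 1ℤ) c                                     ≡⟨ dot-glue 0ℤ m 1ℤ c ⟩
    0ℤ * head c + (sum (λ i → m i * mid c i) + 1ℤ * last c)
      ≡⟨ cong₂ (λ z w → z + (sum (λ i → m i * mid c i) + w)) (ℤ.*-zeroˡ (head c)) (ℤ.*-identityˡ (last c)) ⟩
    0ℤ + (sum (λ i → m i * mid c i) + last c)
      ≡⟨ ℤ.+-identityˡ _ ⟩
    sum (λ i → m i * mid c i) + last c ∎

  diagonalRow : ∀ {k} → Vector ℤ k → Fin k → Vector ℤ k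
  diagonalRow {k} B i = updateAt (replicate k 0ℤ) i (const (B i))

  topRowMatrix : ∀ {k} → ℤ → Vector ℤ k → Vector ℤ k → Matrix (suc (suc k))
  topRowMatrix     P x B zero    = glue P x 1ℤ
  topRowMatrix {k} P x B (suc r) = rowBelow (view r)
    where
    rowBelow : ∀ {r} → View r → Vector ℤ (suc (suc k))
    rowBelow (‵inject₁ i) = glue 0ℤ (diagonalRow B i) 1ℤ
    rowBelow ‵fromℕ       = glue 0ℤ (replicate k 0ℤ) 1ℤ

  module _ {k} (P : ℤ) (x B : Vector ℤ k) where

    private
      A : Matrix (suc (suc k))
      A = topRowMatrix P x B

    topRowMatrix-mid : ∀ i → A (suc (inject₁ i)) ≡ glue 0ℤ (diagonalRow B i) 1ℤ
    topRowMatrix-mid i rewrite view-inject₁ i = refl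

    topRowMatrix-last : A (fromℕ (suc k)) ≡ glue 0ℤ (replicate k 0ℤ) 1ℤ
    topRowMatrix-last rewrite view-fromℕ k = refl

    topRowMatrix-top : ∀ i → A zero (suc (inject₁ i)) ≡ x i
    topRowMatrix-top = mid-glue P x 1ℤ

    topRowMatrix-diagonal : ∀ i → A (suc (inject₁ i)) (suc (inject₁ i)) ≡ B i
    topRowMatrix-diagonal i = begin
      A (suc (inject₁ i)) (suc (inject₁ i))  ≡⟨ cong-app (topRowMatrix-mid i) (suc (inject₁ i)) ⟩
      mid (glue 0ℤ (diagonalRow B i) 1ℤ) i   ≡⟨ mid-glue 0ℤ (diagonalRow B i) 1ℤ i ⟩
      diagonalRow B i i                      ≡⟨ updateAt-updates i (replicate k 0ℤ) ⟩
      B i                                    ∎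

    topRowMatrix-offDiagonal : ∀ i j → j ≢ i → A (suc (inject₁ i)) (suc (inject₁ j)) ≡ 0ℤ
    topRowMatrix-offDiagonal i j j≢i = begin
      A (suc (inject₁ i)) (suc (inject₁ j))  ≡⟨ cong-app (topRowMatrix-mid i) (suc (inject₁ j)) ⟩
      mid (glue 0ℤ (diagonalRow B i) 1ℤ) j   ≡⟨ mid-glue 0ℤ (diagonalRow B i) 1ℤ j ⟩
      diagonalRow B i j                      ≡⟨ updateAt-minimal j i (replicate k 0ℤ) j≢i ⟩
      0ℤ                                     ∎

    topRowMatrix-lastColumn : ∀ r → A r (fromℕ (suc k)) ≡ 1ℤ
    topRowMatrix-lastColumn = byParts _ (last-glue P x 1ℤ)
      (λ i → trans (cong-app (topRowMatrix-mid i) (fromℕ (suc k))) (last-glue 0ℤ (diagonalRow B i) 1ℤ))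
      (trans (cong-app topRowMatrix-last (fromℕ (suc k))) (last-glue 0ℤ (replicate k 0ℤ) 1ℤ))

    topRowMatrix-lower : ∀ r j → toℕ j < toℕ r → A r j ≡ 0ℤ
    topRowMatrix-lower = byParts _ (λ _ ()) lowerMid lowerLast
      where
      lowerMid : ∀ i j → toℕ j < toℕ (suc (inject₁ i)) → A (suc (inject₁ i)) j ≡ 0ℤ
      lowerMid i = byParts _ (λ _ → cong-app (topRowMatrix-mid i) zero)
        (λ j j<i → topRowMatrix-offDiagonal i j λ { refl → ℕ.<-irrefl refl j<i })
        (λ last<i → contradiction (ℕ.s<s⁻¹ last<i) (fromℕ≮inject₁ i))
      lowerLast : ∀ j → toℕ j < toℕ (fromℕ (suc k)) → A (fromℕ (suc k)) j ≡ 0ℤ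
      lowerLast = byParts _ (λ _ → cong-app topRowMatrix-last zero)
        (λ j _ → trans (cong-app topRowMatrix-last (suc (inject₁ j))) (mid-glue 0ℤ (replicate k 0ℤ) 1ℤ j))
        (λ last<last → contradiction last<last (ℕ.<-irrefl refl))

    mulVec-mid : ∀ c i → mulVec A c (suc (inject₁ i)) ≡ B i * mid c i + last c
    mulVec-mid c i = begin
      mulVec A c (suc (inject₁ i))              ≡⟨ cong (λ row → dot row c) (topRowMatrix-mid i) ⟩
      dot (glue 0ℤ (diagonalRow B i) 1ℤ) c      ≡⟨ dot-glue₀₁ (diagonalRow B i) c ⟩
      sum (λ j → diagonalRow B i j * mid c j) + last c
        ≡⟨ cong (_+ last c) (sum-single i _ (λ j j≢i →
             trans (cong (_* mid c j) (updateAt-minimal j i (replicate k 0ℤ) j≢i)) (ℤ.*-zeroˡ (mid c j)))) ⟩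
      diagonalRow B i i * mid c i + last c
        ≡⟨ cong (λ z → z * mid c i + last c) (updateAt-updates i (replicate k 0ℤ)) ⟩
      B i * mid c i + last c                    ∎

    mulVec-last : ∀ c → mulVec A c (fromℕ (suc k)) ≡ last c
    mulVec-last c = begin
      mulVec A c (fromℕ (suc k))           ≡⟨ cong (λ row → dot row c) topRowMatrix-last ⟩
      dot (glue 0ℤ (replicate k 0ℤ) 1ℤ) c  ≡⟨ dot-glue₀₁ (replicate k 0ℤ) c ⟩
      sum (λ j → 0ℤ * mid c j) + last c    ≡⟨ cong (_+ last c) (trans (sum-cong-≗ (λ j → ℤ.*-zeroˡ (mid c j)))
                                                                      (sum-replicate-zero k)) ⟩
      0ℤ + last c                          ≡⟨ ℤ.+-identityˡ (last c) ⟩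
      last c                               ∎

  -- The first coordinates multiply to q Se + cₗ dₗ plus a multiple of P: the leftover
  -- q² Sc Sd - q T equals P (R Sc Sd - U) because q² = P R and q T = P U.
  topEntry-product : ∀ P q R c₀ d₀ Sc Sd cₗ dₗ T U Se →
    q * q ≡ P * R → q * T ≡ P * U → Se ≡ T + (dₗ * Sc + cₗ * Sd) →
    (P * c₀ + q * Sc + cₗ) * (P * d₀ + q * Sd + dₗ) ≡
    P * (c₀ * (P * d₀ + q * Sd + dₗ) + d₀ * (q * Sc + cₗ) + R * (Sc * Sd) - U) + q * Se + cₗ * dₗ
  topEntry-product P q R c₀ d₀ Sc Sd cₗ dₗ T U Se q²≡PR qT≡PU Se≡ = begin
    (P * c₀ + q * Sc + cₗ) * (P * d₀ + q * Sd + dₗ)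
      ≡⟨ expand P q c₀ d₀ Sc Sd cₗ dₗ ⟩
    P * X + q * q * (Sc * Sd) + q * W + cₗ * dₗ
      ≡⟨ cong (λ z → P * X + z * (Sc * Sd) + q * W + cₗ * dₗ) q²≡PR ⟩
    P * X + P * R * (Sc * Sd) + q * W + cₗ * dₗ
      ≡⟨ regroup P q R X (Sc * Sd) W U (cₗ * dₗ) ⟩
    P * (X + R * (Sc * Sd) - U) + (P * U + q * W) + cₗ * dₗ
      ≡⟨ cong (λ z → P * (X + R * (Sc * Sd) - U) + (z + q * W) + cₗ * dₗ) (sym qT≡PU) ⟩
    P * (X + R * (Sc * Sd) - U) + (q * T + q * W) + cₗ * dₗ
      ≡⟨ cong (λ z → P * (X + R * (Sc * Sd) - U) + z + cₗ * dₗ)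
              (trans (sym (ℤ.*-distribˡ-+ q T W)) (cong (q *_) (sym Se≡))) ⟩
    P * (X + R * (Sc * Sd) - U) + q * Se + cₗ * dₗ ∎
    where
    X = c₀ * (P * d₀ + q * Sd + dₗ) + d₀ * (q * Sc + cₗ)
    W = dₗ * Sc + cₗ * Sd
    expand : ∀ P q c₀ d₀ Sc Sd cₗ dₗ → (P * c₀ + q * Sc + cₗ) * (P * d₀ + q * Sd + dₗ) ≡
             P * (c₀ * (P * d₀ + q * Sd + dₗ) + d₀ * (q * Sc + cₗ)) + q * q * (Sc * Sd)
               + q * (dₗ * Sc + cₗ * Sd) + cₗ * dₗ
    expand = solve-∀
    regroup : ∀ P q R X Y W U Z → P * X + P * R * Y + q * W + Z ≡ P * (X + R * Y - U) + (P * U + q * W) + Z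
    regroup = solve-∀

  *-exchange : ∀ q P w m {Bᵢ Cᵢ} → q * Bᵢ ≡ P * Cᵢ → q * (w * (Bᵢ * m)) ≡ P * (w * (Cᵢ * m))
  *-exchange q P w m {Bᵢ} {Cᵢ} qB≡PC = begin
    q * (w * (Bᵢ * m))  ≡⟨ pull q w Bᵢ m ⟩
    w * (q * Bᵢ * m)    ≡⟨ cong (λ z → w * (z * m)) qB≡PC ⟩
    w * (P * Cᵢ * m)    ≡⟨ pull P w Cᵢ m ⟨
    P * (w * (Cᵢ * m))  ∎
    where
    pull : ∀ q w Bᵢ m → q * (w * (Bᵢ * m)) ≡ w * (q * Bᵢ * m)
    pull = solve-∀

  module _ {k} (P q R : ℤ) (b B C : Vector ℤ k)
           (q²≡PR : q * q ≡ P * R) (qB≡PC : ∀ i → q * B i ≡ P * C i) where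

    private
      x : Vector ℤ k
      x i = q * b i

      A : Matrix (suc (suc k))
      A = topRowMatrix P x B

      weight : Vector ℤ (suc (suc k)) → ℤ
      weight c = sum (λ i → b i * mid c i)

      mulVec-top : ∀ c → mulVec A c zero ≡ P * head c + q * weight c + last c
      mulVec-top c = begin
        mulVec A c zero                                             ≡⟨ dot-glue P x 1ℤ c ⟩
        P * head c + (sum (λ i → q * b i * mid c i) + 1ℤ * last c)  ≡⟨ cong₂ (λ s l → P * head c + (s + l))
                                                                              factor (ℤ.*-identityˡ (last c)) ⟩
        P * head c + (q * weight c + last c)                        ≡⟨ ℤ.+-assoc (P * head c) _ _ ⟨
        P * head c + q * weight c + last c                          ∎
        where
        factor : sum (λ i → q * b i * mid c i) ≡ q * weight c
        factor = trans (sum-cong-≗ (λ i → ℤ.*-assoc q (b i) (mid c i)))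
                       (sym (*-distribˡ-sum q (λ i → b i * mid c i)))

      module Product (c d : Vector ℤ (suc (suc k))) where

        cd : Vector ℤ k
        cd i = mid c i * mid d i

        T U : ℤ
        T = sum (λ i → b i * (B i * cd i))
        U = sum (λ i → b i * (C i * cd i))

        e₀ : ℤ
        e₀ = head c * (P * head d + q * weight d + last d) + head d * (q * weight c + last c)
             + R * (weight c * weight d) - U

        eₘ : Vector ℤ k
        eₘ i = B i * cd i + mid c i * last d + last c * mid d i

        e : Vector ℤ (suc (suc k))
        e = glue e₀ eₘ (last c * last d)

        qT≡PU : q * T ≡ P * U
        qT≡PU = begin
          q * T                                ≡⟨ *-distribˡ-sum q (λ i → b i * (B i * cd i)) ⟩
          sum (λ i → q * (b i * (B i * cd i)))  ≡⟨ sum-cong-≗ (λ i → *-exchange q P (b i) (cd i) (qB≡PC i)) ⟩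
          sum (λ i → P * (b i * (C i * cd i)))  ≡⟨ *-distribˡ-sum P (λ i → b i * (C i * cd i)) ⟨
          P * U                                ∎

        weight-e : weight e ≡ T + (last d * weight c + last c * weight d)
        weight-e = begin
          sum (λ i → b i * mid e i)
            ≡⟨ sum-cong-≗ (λ i → trans (cong (b i *_) (mid-glue e₀ eₘ _ i))
                                       (spread (b i) (B i) (mid c i) (mid d i) (last c) (last d))) ⟩
          sum (λ i → b i * (B i * cd i) + (last d * (b i * mid c i) + last c * (b i * mid d i)))
            ≡⟨ ∑-distrib-+ (λ i → b i * (B i * cd i)) _ ⟩
          T + sum (λ i → last d * (b i * mid c i) + last c * (b i * mid d i))
            ≡⟨ cong (_+_ T) (∑-distrib-+ (λ i → last d * (b i * mid c i)) _) ⟩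
          T + (sum (λ i → last d * (b i * mid c i)) + sum (λ i → last c * (b i * mid d i)))
            ≡⟨ cong₂ (λ s t → T + (s + t)) (*-distribˡ-sum (last d) (λ i → b i * mid c i))
                                            (*-distribˡ-sum (last c) (λ i → b i * mid d i)) ⟨
          T + (last d * weight c + last c * weight d) ∎
          where
          spread : ∀ w Bᵢ x y l m → w * (Bᵢ * (x * y) + x * m + l * y) ≡
                                    w * (Bᵢ * (x * y)) + (m * (w * x) + l * (w * y))
          spread = solve-∀

        mulVec-*-top : mulVec A c zero * mulVec A d zero ≡ mulVec A e zero
        mulVec-*-top = begin
          mulVec A c zero * mulVec A d zero
            ≡⟨ cong₂ _*_ (mulVec-top c) (mulVec-top d) ⟩
          (P * head c + q * weight c + last c) * (P * head d + q * weight d + last d)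
            ≡⟨ topEntry-product P q R (head c) (head d) (weight c) (weight d) (last c) (last d)
                                T U (weight e) q²≡PR qT≡PU weight-e ⟩
          P * head e + q * weight e + last c * last d
            ≡⟨ cong (_+_ (P * head e + q * weight e)) (last-glue e₀ eₘ _) ⟨
          P * head e + q * weight e + last e
            ≡⟨ mulVec-top e ⟨
          mulVec A e zero ∎

        mulVec-*-mid : ∀ i → mulVec A c (suc (inject₁ i)) * mulVec A d (suc (inject₁ i)) ≡
                             mulVec A e (suc (inject₁ i))
        mulVec-*-mid i = begin
          mulVec A c (suc (inject₁ i)) * mulVec A d (suc (inject₁ i))
            ≡⟨ cong₂ _*_ (mulVec-mid P x B c i) (mulVec-mid P x B d i) ⟩
          (B i * mid c i + last c) * (B i * mid d i + last d)
            ≡⟨ distribute (B i) (mid c i) (mid d i) (last c) (last d) ⟩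
          B i * eₘ i + last c * last d
            ≡⟨ cong₂ (λ y l → B i * y + l) (mid-glue e₀ eₘ _ i) (last-glue e₀ eₘ _) ⟨
          B i * mid e i + last e
            ≡⟨ mulVec-mid P x B e i ⟨
          mulVec A e (suc (inject₁ i)) ∎
          where
          distribute : ∀ Bᵢ x y l m → (Bᵢ * x + l) * (Bᵢ * y + m) ≡
                                      Bᵢ * (Bᵢ * (x * y) + x * m + l * y) + l * m
          distribute = solve-∀

        mulVec-*-last : mulVec A c (fromℕ (suc k)) * mulVec A d (fromℕ (suc k)) ≡
                        mulVec A e (fromℕ (suc k))
        mulVec-*-last = begin
          mulVec A c (fromℕ (suc k)) * mulVec A d (fromℕ (suc k))
            ≡⟨ cong₂ _*_ (mulVec-last P x B c) (mulVec-last P x B d) ⟩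
          last c * last d
            ≡⟨ last-glue e₀ eₘ _ ⟨
          last e
            ≡⟨ mulVec-last P x B e ⟨
          mulVec A e (fromℕ (suc k)) ∎

    spanMulClosed : SpanMulClosed (topRowMatrix P (λ i → q * b i) B)
    spanMulClosed u v (c , u≡Ac) (d , v≡Ad) = e , λ r → begin
      u r * v r                    ≡⟨ cong₂ _*_ (u≡Ac r) (v≡Ad r) ⟩
      mulVec A c r * mulVec A d r  ≡⟨ byParts (λ r → mulVec A c r * mulVec A d r ≡ mulVec A e r)
                                              mulVec-*-top mulVec-*-mid mulVec-*-last r ⟩
      mulVec A e r                 ∎
      where open Product c d

  isIrredSubringMatrix : ∀ {k} p .{{_ : NonZero p}} (β : Fin (suc k) → ℕ) (x : Vector ℤ k) →
    (∀ i → ∃ λ a → a < p ℕ.^ (β zero ∸ 1) × x i ≡ + (p ℕ.* a)) →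
    SpanMulClosed (topRowMatrix (+ (p ℕ.^ β zero)) x (λ i → + (p ℕ.^ β (suc i)))) →
    IsIrredSubringMatrix p β (topRowMatrix (+ (p ℕ.^ β zero)) x (λ i → + (p ℕ.^ β (suc i))))
  isIrredSubringMatrix p β x reduced closed = record
    { upperTriangular = topRowMatrix-lower P x B
    ; diag            = diag
    ; lastDiag        = topRowMatrix-lastColumn P x B (fromℕ _)
    ; lastColumn      = topRowMatrix-lastColumn P x B
    ; offDiag         = offDiag
    ; subring         = closed
    }
    where
    P = + (p ℕ.^ β zero)
    B = λ i → + (p ℕ.^ β (suc i))
    diag : ∀ i → topRowMatrix P x B (inject₁ i) (inject₁ i) ≡ + (p ℕ.^ β i)
    diag zero    = refl
    diag (suc i) = topRowMatrix-diagonal P x B i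
    offDiag : ∀ i j → toℕ i < toℕ j →
              ∃ λ a → a < p ℕ.^ (β i ∸ 1) × topRowMatrix P x B (inject₁ i) (inject₁ j) ≡ + (p ℕ.* a)
    offDiag zero    (suc j) _   with reduced j
    ... | a , a<p^ , xⱼ≡pa = a , a<p^ , trans (topRowMatrix-top P x B j) xⱼ≡pa
    offDiag (suc i) (suc j) i<j = 0 , ℕ.m^n>0 p (β (suc i) ∸ 1) ,
      trans (topRowMatrix-offDiagonal P x B i j λ { refl → ℕ.<-irrefl refl i<j })
            (cong +_ (sym (ℕ.*-zeroʳ p)))

  pow*pow≡pow*pow : ∀ p a b {m} → m ≤ a ℕ.+ b →
                    + (p ℕ.^ a) * + (p ℕ.^ b) ≡ + (p ℕ.^ m) * + (p ℕ.^ (a ℕ.+ b ∸ m))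
  pow*pow≡pow*pow p a b {m} m≤a+b = begin
    + (p ℕ.^ a) * + (p ℕ.^ b)              ≡⟨ ℤ.pos-* (p ℕ.^ a) (p ℕ.^ b) ⟨
    + (p ℕ.^ a ℕ.* p ℕ.^ b)                ≡⟨ cong +_ (ℕ.^-distribˡ-+-* p a b) ⟨
    + (p ℕ.^ (a ℕ.+ b))                    ≡⟨ cong (λ n → + (p ℕ.^ n)) (ℕ.m+[n∸m]≡n m≤a+b) ⟨
    + (p ℕ.^ (m ℕ.+ (a ℕ.+ b ∸ m)))        ≡⟨ cong +_ (ℕ.^-distribˡ-+-* p m _) ⟩
    + (p ℕ.^ m ℕ.* p ℕ.^ (a ℕ.+ b ∸ m))    ≡⟨ ℤ.pos-* (p ℕ.^ m) _ ⟩
    + (p ℕ.^ m) * + (p ℕ.^ (a ℕ.+ b ∸ m))  ∎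

  module IrredSubringMatrixFamily (p : ℕ) .{{_ : NonZero p}} (k : ℕ) (β : Fin (suc k) → ℕ) (M : ℕ)
           (M<β₀ : M < β zero) (M+M≤β₀ : M ℕ.+ M ≤ β zero) (M≤β : ∀ i → M ≤ β (suc i)) where

    private
      s : ℕ
      s = β zero ∸ suc M

      β₀≡1+s+M : β zero ≡ suc s ℕ.+ M
      β₀≡1+s+M = trans (sym (ℕ.m∸n+n≡m M<β₀)) (ℕ.+-suc s M)

      M≤1+s : M ≤ suc s
      M≤1+s = ℕ.+-cancelʳ-≤ M M (suc s) (subst (M ℕ.+ M ≤_) β₀≡1+s+M M+M≤β₀)

      P q R : ℤ
      P = + (p ℕ.^ β zero)
      q = + (p ℕ.^ suc s)
      R = + (p ℕ.^ (suc s ℕ.+ suc s ∸ β zero))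

      B C : Vector ℤ k
      B i = + (p ℕ.^ β (suc i))
      C i = + (p ℕ.^ (suc s ℕ.+ β (suc i) ∸ β zero))

      q²≡PR : q * q ≡ P * R
      q²≡PR = pow*pow≡pow*pow p (suc s) (suc s)
        (subst (_≤ suc s ℕ.+ suc s) (sym β₀≡1+s+M) (ℕ.+-monoʳ-≤ (suc s) M≤1+s))

      qB≡PC : ∀ i → q * B i ≡ P * C i
      qB≡PC i = pow*pow≡pow*pow p (suc s) (β (suc i))
        (subst (_≤ suc s ℕ.+ β (suc i)) (sym β₀≡1+s+M) (ℕ.+-monoʳ-≤ (suc s) (M≤β i)))

      digits : Fin (p ℕ.^ (k ℕ.* M)) → Fin k → Fin (p ℕ.^ M)
      digits t = finToFun (cast (trans (cong (p ℕ.^_) (ℕ.*-comm k M)) (sym (ℕ.^-*-assoc p M k))) t)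

      b : Fin (p ℕ.^ (k ℕ.* M)) → Vector ℤ k
      b t i = + toℕ (digits t i)

      top-reduced : ∀ t i → ∃ λ a → a < p ℕ.^ (β zero ∸ 1) × q * b t i ≡ + (p ℕ.* a)
      top-reduced t i = p ℕ.^ s ℕ.* d , bound , factor
        where
        d = toℕ (digits t i)
        bound : p ℕ.^ s ℕ.* d < p ℕ.^ (β zero ∸ 1)
        bound = subst (p ℕ.^ s ℕ.* d <_)
          (trans (sym (ℕ.^-distribˡ-+-* p s M)) (cong (λ n → p ℕ.^ (n ∸ 1)) (sym β₀≡1+s+M)))
          (ℕ.*-monoʳ-< (p ℕ.^ s) {{ℕ.m^n≢0 p s}} (toℕ<n (digits t i)))
        factor : q * + d ≡ + (p ℕ.* (p ℕ.^ s ℕ.* d))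
        factor = trans (sym (ℤ.pos-* (p ℕ.^ suc s) d)) (cong +_ (ℕ.*-assoc p (p ℕ.^ s) d))

    F : Fin (p ℕ.^ (k ℕ.* M)) → Matrix (suc (suc k))
    F t = topRowMatrix P (λ i → q * b t i) B

    F-irreducible : ∀ t → IsIrredSubringMatrix p β (F t)
    F-irreducible t = isIrredSubringMatrix p β (λ i → q * b t i) (top-reduced t)
      (spanMulClosed P q R (b t) B C q²≡PR qB≡PC)

    F-injective : ∀ u t → (∀ r c → F u r c ≡ F t r c) → u ≡ t
    F-injective u t Fu≡Ft = cast-injective _ (finToFun-injective λ i →
      toℕ-injective (ℤ.+-injective (ℤ.*-cancelˡ-≡ q (b u i) (b t i) {{ℕ.m^n≢0 p (suc s)}} (begin
        q * b u i                   ≡⟨ topRowMatrix-top P _ B i ⟨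
        F u zero (suc (inject₁ i))  ≡⟨ Fu≡Ft zero (suc (inject₁ i)) ⟩
        F t zero (suc (inject₁ i))  ≡⟨ topRowMatrix-top P _ B i ⟩
        q * b t i                   ∎))))

open import Data.Nat using (_+_; _*_; _^_; _/_; _⊓_)
open import Data.Nat.DivMod using (m/n<m; m/n*n≤m)
open import Data.Nat.Primality using (Prime; prime⇒nonZero)

minFrom≤start : ∀ {m} a (v : Fin m → ℕ) → minFrom a v ≤ a
minFrom≤start {zero}  a v = ℕ.≤-refl
minFrom≤start {suc m} a v = ℕ.≤-trans (minFrom≤start (a ⊓ v zero) (tail v)) (ℕ.m⊓n≤m a (v zero))

minFrom≤entry : ∀ {m} a (v : Fin m → ℕ) i → minFrom a v ≤ v i
minFrom≤entry {suc m} a v zero    = ℕ.≤-trans (minFrom≤start (a ⊓ v zero) (tail v)) (ℕ.m⊓n≤n a (v zero))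
minFrom≤entry {suc m} a v (suc i) = minFrom≤entry (a ⊓ v zero) (tail v) i

n/2+n/2≤n : ∀ n → n / 2 + n / 2 ≤ n
n/2+n/2≤n n = ℕ.≤-trans (ℕ.≤-reflexive (begin
  n / 2 + n / 2        ≡⟨ cong (n / 2 +_) (ℕ.+-identityʳ (n / 2)) ⟨
  n / 2 + (n / 2 + 0)  ≡⟨ ℕ.*-comm 2 (n / 2) ⟩
  n / 2 * 2            ∎)) (m/n*n≤m n 2)

proposition7p5 : (p k : ℕ) (β : Fin (suc k) → ℕ) → Prime p →
    1 < β zero → (∀ (i : Fin k) → 0 < β (suc i)) → suc (suc k) < sumℕ β →
    Σ (Fin (p ^ (k * mβ β)) → Matrix (suc (suc k))) λ F →
      (∀ t → IsIrredSubringMatrix p β (F t)) ×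
      (∀ s t → (∀ r c → F s r c ≡ F t r c) → s ≡ t)
proposition7p5 p k β p-prime 1<β₀ _ _ = F , F-irreducible , F-injective
  where
  instance
    p≢0 : NonZero p
    p≢0 = prime⇒nonZero p-prime

  M≤β₀/2 : mβ β ≤ β zero / 2
  M≤β₀/2 = minFrom≤start (β zero / 2) (tail β)

  M<β₀ : mβ β < β zero
  M<β₀ = ℕ.≤-<-trans M≤β₀/2 (m/n<m (β zero) 2 {{ℕ.>-nonZero (ℕ.<-trans ℕ.z<s 1<β₀)}} (ℕ.s<s ℕ.z<s))

  M+M≤β₀ : mβ β + mβ β ≤ β zero
  M+M≤β₀ = ℕ.≤-trans (ℕ.+-mono-≤ M≤β₀/2 M≤β₀/2) (n/2+n/2≤n (β zero))

  open IrredSubringMatrixFamily p k β (mβ β) M<β₀ M+M≤β₀ (minFrom≤entry (β zero / 2) (tail β))
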